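{- Let $l\geqslant 2$ and $s,t\geqslant 1$ be integers, and let $G=K_{s,t}$ be a complete bipartite graph with $V(G)\subset[n]$, edge-colored so that each edge $e$ receives a color $z_e\in[n]\setminus e$. If $G$ contains a strongly rainbow colored cycle of length congruent to $2$ modulo $2l-2$, then $G$ contains a strongly rainbow colored cycle of length $2l$.
   Context: A subgraph $G'\subset G$ is rainbow colored if its edges receive pairwise distinct colors, and strongly rainbow colored if it is rainbow colored and additionally $z_e\notin V(G')$ for every $e\in G'$. -}

module Defs where

open import Data.Nat using (ℕ; zero; suc; _≤_)
open import Data.Nat.DivMod using (_mod_)
open import Data.Fin using (Fin; toℕ)
open import Data.Sum using (_⊎_)
open import Data.Product using (Σ; _×_; proj₁; proj₂)
open import Relation.Binary.PropositionalEquality using (_≡_; _≢_)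
open import Function.Definitions using (Injective)

next : ∀ {k} → Fin k → Fin k
next {suc m} i = suc (toℕ i) mod suc m

-- Part A = image of the injection a : Fin s → Fin n, part B = image of b : Fin t → Fin n,
-- A and B disjoint; every a i is joined to every b j, and the edge {a i, b j}
-- receives colour z i j ∈ [n] ∖ {a i, b j}.
record ColoredKst (n s t : ℕ) : Set where
  field
    a : Fin s → Fin n
    b : Fin t → Fin n
    a-inj : Injective _≡_ _≡_ a
    b-inj : Injective _≡_ _≡_ b
    disjoint : ∀ i j → a i ≢ b j
    z : Fin s → Fin t → Fin n
    z≢a : ∀ i j → z i j ≢ a i
    z≢b : ∀ i j → z i j ≢ b j

-- A strongly rainbow coloured cycle of length k in G:
-- distinct vertices c 0, …, c (k-1) (k ≥ 3), where the p-th edge {c p, c (p+1 mod k)}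
-- is the edge {a i, b j} of G with (i , j) = e p; the colours of the k edges are
-- pairwise distinct (rainbow), and no colour is a vertex of the cycle (strong).
record StronglyRainbowCycle {n s t : ℕ} (G : ColoredKst n s t) (k : ℕ) : Set where
  open ColoredKst G
  field
    k≥3 : 3 ≤ k
    c : Fin k → Fin n
    c-inj : Injective _≡_ _≡_ c
    e : Fin k → Fin s × Fin t
    edge : ∀ p → (c p ≡ a (proj₁ (e p)) × c (next p) ≡ b (proj₂ (e p)))
               ⊎ (c p ≡ b (proj₂ (e p)) × c (next p) ≡ a (proj₁ (e p)))
  colour : Fin k → Fin n
  colour p = z (proj₁ (e p)) (proj₂ (e p))
  field
    rainbow : Injective _≡_ _≡_ colour
    strong : ∀ p q → colour p ≢ c q

-- In K_{s,t} two vertices at odd distance along a cycle lie in opposite parts, hence are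
-- joined by an edge of G, a chord splitting the cycle into two shorter cycles. With 2l = 2h+2,
-- take the chord from the first vertex to the one at distance 2h+1. If its colour clashes
-- (as an edge colour or as a vertex) with nothing on the short arc, the short arc and the
-- chord form a strongly rainbow cycle of length 2l. Otherwise, as in a strongly rainbow cycle
-- a colour clashes with at most one position, it clashes with nothing on the long arc, and the
-- long arc with the chord is a strongly rainbow cycle 2h = 2l-2 shorter. Lengths ≡ 2
-- (mod 2l-2) thus descend to 2l.
module Submission where

open import Defs
open import Data.Bool using (Bool; true; false; not)
open import Data.Nat using (ℕ; zero; suc; _≤_; _<_; _+_; _*_; _∸_; z≤n; s≤s; s≤s⁻¹; _%_)
open import Data.Nat.Properties
open import Data.Nat.DivMod using (_mod_; m<n⇒m%n≡m; n%n≡0)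
open import Data.Nat.Tactic.RingSolver using (solve-∀)
open import Data.Fin using (Fin; toℕ)
import Data.Fin.Properties as Fin
open import Data.Product using (∃; _×_; _,_; proj₁)
open import Data.Sum using (_⊎_; inj₁; inj₂; [_,_])
open import Data.Empty using (⊥-elim)
open import Relation.Nullary using (Dec; yes; no; ¬_)
open import Relation.Nullary.Decidable using (_⊎-dec_)
open import Relation.Binary.PropositionalEquality hiding ([_])
open import Function using (_∘_; id)

module _ {n s t : ℕ} (G : ColoredKst n s t) where
  open ColoredKst G

  Edge : Set
  Edge = Fin s × Fin t

  colour : Edge → Fin n
  colour (i , j) = z i j

  Joins : Edge → Fin n → Fin n → Set
  Joins (i , j) x y = (x ≡ a i × y ≡ b j) ⊎ (x ≡ b j × y ≡ a i)

  joins-sym : ∀ {e x y} → Joins e x y → Joins e y x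
  joins-sym (inj₁ (p , q)) = inj₂ (q , p)
  joins-sym (inj₂ (p , q)) = inj₁ (q , p)

  colour-avoids-ends : ∀ {e x y} → Joins e x y → colour e ≢ x × colour e ≢ y
  colour-avoids-ends {i , j} (inj₁ (refl , refl)) = z≢a i j , z≢b i j
  colour-avoids-ends {i , j} (inj₂ (refl , refl)) = z≢b i j , z≢a i j

  InPart : Bool → Fin n → Set
  InPart true  x = ∃ λ i → x ≡ a i
  InPart false x = ∃ λ j → x ≡ b j

  joins-opposite : ∀ {e x y} σ → Joins e x y → InPart σ x → InPart (not σ) y
  joins-opposite true  (inj₁ (_ , q)) _       = _ , q
  joins-opposite true  (inj₂ (p , _)) (i , r) = ⊥-elim (disjoint i _ (trans (sym r) p))
  joins-opposite false (inj₂ (_ , q)) _       = _ , q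
  joins-opposite false (inj₁ (p , _)) (j , r) = ⊥-elim (disjoint _ j (trans (sym p) r))

  two-steps-same-part : ∀ {e e′ x y w} σ → Joins e x y → Joins e′ y w → InPart σ x → InPart σ w
  two-steps-same-part true  xy yw = joins-opposite false yw ∘ joins-opposite true xy
  two-steps-same-part false xy yw = joins-opposite true yw ∘ joins-opposite false xy

  part-of-endpoint : ∀ {e x y} → Joins e x y → ∃ λ σ → InPart σ x
  part-of-endpoint (inj₁ (p , _)) = true , _ , p
  part-of-endpoint (inj₂ (p , _)) = false , _ , p

  opposite-parts-joined : ∀ {x y} σ → InPart σ x → InPart (not σ) y → ∃ λ e → Joins e x y
  opposite-parts-joined true  (i , p) (j , q) = (i , j) , inj₁ (p , q)
  opposite-parts-joined false (j , p) (i , q) = (i , j) , inj₂ (p , q)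

  record Cycle (k : ℕ) : Set where
    field
      vertex : ℕ → Fin n
      edge : ℕ → Edge
      closed : vertex k ≡ vertex 0
      joins : ∀ p → p < k → Joins (edge p) (vertex p) (vertex (suc p))
      vertex-injective : ∀ p q → p < k → q < k → vertex p ≡ vertex q → p ≡ q
      rainbow : ∀ p q → p < k → q < k → colour (edge p) ≡ colour (edge q) → p ≡ q
      strong : ∀ p q → p < k → q < k → colour (edge p) ≢ vertex q

    Clash : Fin n → ℕ → Set
    Clash c p = c ≡ colour (edge p) ⊎ c ≡ vertex p

    clash? : ∀ c p → Dec (Clash c p)
    clash? c p = (c Fin.≟ colour (edge p)) ⊎-dec (c Fin.≟ vertex p)

    clash-unique : ∀ {c p q} → p < k → q < k → Clash c p → Clash c q → p ≡ q
    clash-unique p<k q<k (inj₁ refl) (inj₁ eq) = rainbow _ _ p<k q<k eq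
    clash-unique p<k q<k (inj₁ refl) (inj₂ eq) = ⊥-elim (strong _ _ p<k q<k eq)
    clash-unique p<k q<k (inj₂ refl) (inj₁ eq) = ⊥-elim (strong _ _ q<k p<k (sym eq))
    clash-unique p<k q<k (inj₂ refl) (inj₂ eq) = vertex-injective _ _ p<k q<k eq

    part-at-even : ∀ σ r → r + r < k → InPart σ (vertex 0) → InPart σ (vertex (r + r))
    part-at-even σ zero _ = id
    part-at-even σ (suc r) lt rewrite +-suc r r =
      two-steps-same-part σ (joins (r + r) (<-trans (n<1+n _) r+r+1<k)) (joins _ r+r+1<k)
        ∘ part-at-even σ r (<-trans (n<1+n _) (<-trans (n<1+n _) lt))
      where
      r+r+1<k : suc (r + r) < k
      r+r+1<k = <-trans (n<1+n _) lt

    odd-chord : ∀ r → suc (r + r) < k → ∃ λ e → Joins e (vertex 0) (vertex (suc (r + r)))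
    odd-chord r lt =
      let σ , v₀ = part-of-endpoint (joins 0 (≤-<-trans z≤n lt))
      in opposite-parts-joined σ v₀
           (joins-opposite σ (joins (r + r) (<-trans (n<1+n _) lt))
                             (part-at-even σ r (<-trans (n<1+n _) lt) v₀))

    -- The arc from vertex i to vertex (m + i), closed up by an edge e back to vertex i. The
    -- endpoint is also named by a position j < k, since m + i may be k (then j = 0). Indexing
    -- the arc by p + i keeps each step of joins definitional.
    shortcut : ∀ i m j e → m + i ≤ k → j < k → vertex (m + i) ≡ vertex j →
               (∀ p → p < m → p + i ≢ j) → Joins e (vertex j) (vertex i) →
               (∀ p → p < m → ¬ Clash (colour e) (p + i)) → Cycle (suc m)
    shortcut i m j e m+i≤k j<k end fresh e-joins avoids = record
      { vertex = vertex′ ; edge = edge′ ; closed = end ; joins = joins′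
      ; vertex-injective = injective′ ; rainbow = rainbow′ ; strong = strong′ }
      where
      vertex′ : ℕ → Fin n
      vertex′ zero = vertex j
      vertex′ (suc p) = vertex (p + i)
      edge′ : ℕ → Edge
      edge′ zero = e
      edge′ (suc p) = edge (p + i)
      inside : ∀ {p} → suc p < suc m → p + i < k
      inside {p} lt = <-≤-trans (+-monoˡ-< i (s≤s⁻¹ lt)) m+i≤k
      joins′ : ∀ p → p < suc m → Joins (edge′ p) (vertex′ p) (vertex′ (suc p))
      joins′ zero _ = e-joins
      joins′ (suc p) lt = joins (p + i) (inside lt)
      injective′ : ∀ p q → p < suc m → q < suc m → vertex′ p ≡ vertex′ q → p ≡ q
      injective′ zero zero _ _ _ = refl
      injective′ zero (suc q) _ lt eq =
        ⊥-elim (fresh q (s≤s⁻¹ lt) (vertex-injective _ _ (inside lt) j<k (sym eq)))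
      injective′ (suc p) zero lt _ eq =
        ⊥-elim (fresh p (s≤s⁻¹ lt) (vertex-injective _ _ (inside lt) j<k eq))
      injective′ (suc p) (suc q) lp lq eq =
        cong suc (+-cancelʳ-≡ i p q (vertex-injective _ _ (inside lp) (inside lq) eq))
      rainbow′ : ∀ p q → p < suc m → q < suc m → colour (edge′ p) ≡ colour (edge′ q) → p ≡ q
      rainbow′ zero zero _ _ _ = refl
      rainbow′ zero (suc q) _ lt eq = ⊥-elim (avoids q (s≤s⁻¹ lt) (inj₁ eq))
      rainbow′ (suc p) zero lt _ eq = ⊥-elim (avoids p (s≤s⁻¹ lt) (inj₁ (sym eq)))
      rainbow′ (suc p) (suc q) lp lq eq =
        cong suc (+-cancelʳ-≡ i p q (rainbow _ _ (inside lp) (inside lq) eq))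
      strong′ : ∀ p q → p < suc m → q < suc m → colour (edge′ p) ≢ vertex′ q
      strong′ zero zero _ _ = proj₁ (colour-avoids-ends e-joins)
      strong′ zero (suc q) _ lt = avoids q (s≤s⁻¹ lt) ∘ inj₂
      strong′ (suc p) zero lt _ = strong _ _ (inside lt) j<k
      strong′ (suc p) (suc q) lp lq = strong _ _ (inside lp) (inside lq)

  split-at-chord : ∀ K d (C : Cycle (K + d)) → 0 < K → 0 < d →
                   (∃ λ e → Joins e (Cycle.vertex C 0) (Cycle.vertex C d)) →
                   Cycle (suc d) ⊎ Cycle (suc K)
  split-at-chord K d C 0<K 0<d (e , chord) with anyUpTo? (Cycle.clash? C (colour e)) d
  ... | yes (p , p<d , clash) =
    inj₂ (shortcut d K 0 e ≤-refl 0<k closed (λ q _ → >⇒≢ 0<d ∘ m+n≡0⇒n≡0 q) chord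
                   long-arc-avoids)
    where
    open Cycle C
    0<k : 0 < K + d
    0<k = <-≤-trans 0<d (m≤n+m d K)
    long-arc-avoids : ∀ q → q < K → ¬ Clash (colour e) (q + d)
    long-arc-avoids q q<K clash′ =
      <-irrefl (clash-unique (<-≤-trans p<d (m≤n+m d K)) (+-monoˡ-< d q<K) clash clash′)
               (<-≤-trans p<d (m≤n+m d q))
  ... | no no-clash =
    inj₁ (shortcut 0 d d e d+0≤k d<k (cong vertex (+-identityʳ d)) short-arc-fresh
                   (joins-sym chord) short-arc-avoids)
    where
    open Cycle C
    d<k : d < K + d
    d<k = +-monoˡ-≤ d 0<K
    d+0≤k : d + 0 ≤ K + d
    d+0≤k rewrite +-identityʳ d = <⇒≤ d<k
    short-arc-fresh : ∀ p → p < d → p + 0 ≢ d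
    short-arc-fresh p p<d eq rewrite +-identityʳ p = <-irrefl eq p<d
    short-arc-avoids : ∀ p → p < d → ¬ Clash (colour e) (p + 0)
    short-arc-avoids p p<d clash rewrite +-identityʳ p = no-clash (p , p<d , clash)

  shrink : ∀ h q → Cycle (suc (suc (h + h)) + q * (h + h)) → Cycle (suc (suc (h + h)))
  shrink h zero C = subst Cycle (+-identityʳ _) C
  shrink h (suc q) C =
    [ id , shrink h q ] (split-at-chord K d C′ (s≤s z≤n) (s≤s z≤n) (Cycle.odd-chord C′ h d<k))
    where
    d K : ℕ
    d = suc (h + h)
    K = d + q * (h + h)
    length-split : ∀ h q → suc (suc (h + h)) + suc q * (h + h) ≡
                           (suc (h + h) + q * (h + h)) + suc (h + h)
    length-split = solve-∀
    C′ : Cycle (K + d)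
    C′ = subst Cycle (length-split h q) C
    d<k : d < K + d
    d<k = m<n+m d (s≤s z≤n)

  fromStronglyRainbow : ∀ {k} → StronglyRainbowCycle G k → Cycle k
  fromStronglyRainbow {suc m} C = record
    { vertex = vertex ; edge = edge ; closed = closed ; joins = joins′
    ; vertex-injective = λ p q p<k q<k → index-injective p<k q<k ∘ c-inj
    ; rainbow = λ p q p<k q<k → index-injective p<k q<k ∘ rainbow
    ; strong = λ p q _ _ → strong (p mod suc m) (q mod suc m) }
    where
    open StronglyRainbowCycle C renaming (edge to edge-joins)
    vertex : ℕ → Fin n
    vertex p = c (p mod suc m)
    edge : ℕ → Edge
    edge p = e (p mod suc m)
    toℕ-mod : ∀ {p} → p < suc m → toℕ (p mod suc m) ≡ p
    toℕ-mod p<k = trans (Fin.toℕ-fromℕ< _) (m<n⇒m%n≡m p<k)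
    index-injective : ∀ {p q} → p < suc m → q < suc m → p mod suc m ≡ q mod suc m → p ≡ q
    index-injective p<k q<k eq = trans (sym (toℕ-mod p<k)) (trans (cong toℕ eq) (toℕ-mod q<k))
    closed : vertex (suc m) ≡ vertex 0
    closed = cong c (Fin.toℕ-injective (trans (Fin.toℕ-fromℕ< _) (n%n≡0 (suc m))))
    next-mod : ∀ {p} → p < suc m → next (p mod suc m) ≡ suc p mod suc m
    next-mod {p} p<k = Fin.toℕ-injective (trans (Fin.toℕ-fromℕ< _)
      (trans (cong (λ x → suc x % suc m) (toℕ-mod p<k)) (sym (Fin.toℕ-fromℕ< _))))
    joins′ : ∀ p → p < suc m → Joins (edge p) (vertex p) (vertex (suc p))
    joins′ p p<k = subst (Joins (edge p) (vertex p) ∘ c) (next-mod p<k) (edge-joins (p mod suc m))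

  toStronglyRainbow : ∀ {k} → 3 ≤ k → Cycle k → StronglyRainbowCycle G k
  toStronglyRainbow {suc m} 3≤k C = record
    { k≥3 = 3≤k ; c = vertex ∘ toℕ
    ; c-inj = Fin.toℕ-injective ∘ vertex-injective _ _ (Fin.toℕ<n _) (Fin.toℕ<n _)
    ; e = edge ∘ toℕ ; edge = joins-next
    ; rainbow = Fin.toℕ-injective ∘ rainbow _ _ (Fin.toℕ<n _) (Fin.toℕ<n _)
    ; strong = λ i j → strong _ _ (Fin.toℕ<n i) (Fin.toℕ<n j) }
    where
    open Cycle C
    vertex-next : (i : Fin (suc m)) → suc (toℕ i) < suc m ⊎ suc (toℕ i) ≡ suc m →
                  vertex (toℕ (next i)) ≡ vertex (suc (toℕ i))
    vertex-next i (inj₁ lt) = cong vertex (trans (Fin.toℕ-fromℕ< _) (m<n⇒m%n≡m lt))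
    vertex-next i (inj₂ eq) = begin
      vertex (toℕ (next i))      ≡⟨ cong vertex (Fin.toℕ-fromℕ< _) ⟩
      vertex (suc (toℕ i) % suc m) ≡⟨ cong (λ x → vertex (x % suc m)) eq ⟩
      vertex (suc m % suc m)     ≡⟨ cong vertex (n%n≡0 (suc m)) ⟩
      vertex 0                   ≡⟨ sym closed ⟩
      vertex (suc m)             ≡⟨ cong vertex (sym eq) ⟩
      vertex (suc (toℕ i))       ∎
      where open ≡-Reasoning
    joins-next : ∀ i → Joins (edge (toℕ i)) (vertex (toℕ i)) (vertex (toℕ (next i)))
    joins-next i = subst (Joins (edge (toℕ i)) (vertex (toℕ i)))
                         (sym (vertex-next i (m≤n⇒m<n∨m≡n (Fin.toℕ<n i))))
                         (joins (toℕ i) (Fin.toℕ<n i))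

lemma5p2 : (n l s t : ℕ) → 2 ≤ l → 1 ≤ s → 1 ≤ t → (G : ColoredKst n s t) →
           (∃ λ k → (∃ λ q → k ≡ q * (2 * l ∸ 2) + 2) × StronglyRainbowCycle G k) →
           StronglyRainbowCycle G (2 * l)
lemma5p2 n (suc (suc h)) s t (s≤s (s≤s z≤n)) _ _ G (_ , (zero , refl) , C) =
  ⊥-elim (1+n≰n (s≤s⁻¹ (StronglyRainbowCycle.k≥3 C)))
lemma5p2 n (suc (suc h)) s t (s≤s (s≤s z≤n)) _ _ G (_ , (suc q , refl) , C) =
  subst (StronglyRainbowCycle G) (sym (two-l h))
    (toStronglyRainbow G (s≤s (s≤s (s≤s z≤n)))
      (shrink G (suc h) q (subst (Cycle G) length-form (fromStronglyRainbow G C))))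
  where
  two-l : ∀ h → 2 * suc (suc h) ≡ suc (suc (suc h + suc h))
  two-l = solve-∀
  length-form : suc q * (2 * suc (suc h) ∸ 2) + 2 ≡
                suc (suc (suc h + suc h)) + q * (suc h + suc h)
  length-form = begin
    suc q * (2 * suc (suc h) ∸ 2) + 2
      ≡⟨ cong (λ x → suc q * x + 2) (*-distribˡ-∸ 2 (suc (suc h)) 1) ⟨
    suc q * (2 * suc h) + 2
      ≡⟨ double-length h q ⟩
    suc (suc (suc h + suc h)) + q * (suc h + suc h) ∎
    where
    open ≡-Reasoning
    double-length : ∀ h q → suc q * (2 * suc h) + 2 ≡
                            suc (suc (suc h + suc h)) + q * (suc h + suc h)
    double-length = solve-∀
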